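{- Let $G$ be a graph and let $X$ be a subset of vertices of $G$. Then $\mathrm{cmp}(G)\le\mathrm{cmp}(G-X)+|X|$.
   Context: All graphs are finite, simple and undirected. A forest decomposition of $G$ is a pair $(F,(W_x)_{x\in V(F)})$ with $F$ a forest and $W_x\subseteq V(G)$, such that for every vertex $u$ of $G$ the set $\{x\in V(F):u\in W_x\}$ induces a nonempty connected subgraph of $F$, and every edge $uv$ of $G$ has both endpoints in some bag $W_x$. It is suitable if moreover $F$ is a subgraph of $G$ with $V(F)=V(G)$ and $u\in W_u$ for every $u\in V(G)$. Its width is the maximum bag size minus one. The complexity $\mathrm{cmp}(G)$ is the minimum width of a suitable forest decomposition of $G$ (every graph has one), with $\mathrm{cmp}(G)\coloneqq0$ when $G$ has no vertices. -}

module Defs where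

open import Level using (0ℓ)
open import Data.Nat using (ℕ; suc; _∸_; _⊔_; _≤_)
open import Data.Fin using (Fin)
open import Data.Fin.Subset using (Subset; _∈_; _∉_; _⊆_; _∩_; ∁; ∣_∣)
open import Data.List using (List; _∷_; []; length; foldr; map; allFin; _∷ʳ_)
open import Data.List.Relation.Unary.Unique.Propositional using (Unique)
open import Data.List.Relation.Unary.Linked using (Linked)
open import Data.Vec using (lookup)
open import Data.Bool using (if_then_else_)
open import Data.Product using (Σ; ∃; _×_)
open import Relation.Binary.Construct.Closure.ReflexiveTransitive using (Star)
open import Relation.Binary.PropositionalEquality using (_≡_)
open import Relation.Nullary using (¬_)

-- A finite simple undirected graph. Its vertex set is a subset V of an
-- ambient finite type Fin N (this makes vertex deletion G - X direct).
record Graph : Set₁ where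
  field
    N     : ℕ
    V     : Subset N
    Adj   : Fin N → Fin N → Set
    sym   : ∀ {u v} → Adj u v → Adj v u
    irr   : ∀ {u} → ¬ Adj u u
    adjV  : ∀ {u v} → Adj u v → u ∈ V × v ∈ V
open Graph public

_─_ : (G : Graph) → Subset (N G) → Graph
G ─ X = record
  { N = N G
  ; V = V G ∩ ∁ X
  ; Adj = λ u v → Adj G u v × u ∉ X × v ∉ X
  ; sym = λ (a , p , q) → sym G a , q , p
  ; irr = λ (a , _ , _) → irr G a
  ; adjV = λ (a , p , q) → (∈∩ (proj₁ (adjV G a)) p) , ∈∩ (proj₂ (adjV G a)) q
  }
  where
  open import Data.Product using (_,_; proj₁; proj₂)
  open import Data.Fin.Subset.Properties using (x∈p∩q⁺; x∉p⇒x∈∁p)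
  ∈∩ : ∀ {x} → x ∈ V G → x ∉ X → x ∈ (V G ∩ ∁ X)
  ∈∩ p q = x∈p∩q⁺ (p , x∉p⇒x∈∁p q)

IsCycle : ∀ {N} → (Fin N → Fin N → Set) → Fin N → List (Fin N) → Set
IsCycle R v vs = Unique (v ∷ vs) × 2 ≤ length vs × Linked R ((v ∷ vs) ∷ʳ v)

InducedConnected : ∀ {N} → (Fin N → Fin N → Set) → (Fin N → Set) → Set
InducedConnected R S =
  ∀ {x y} → S x → S y → Star (λ a b → R a b × S a × S b) x y

-- A suitable forest decomposition of G: a forest F which is a subgraph of G
-- with V(F) = V(G) (given by its symmetric edge relation FE on V(G)),
-- together with bags W x ⊆ V(G) for x ∈ V(G).
record SuitableFD (G : Graph) : Set₁ where
  field
    FE       : Fin (N G) → Fin (N G) → Set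
    FE-sym   : ∀ {u v} → FE u v → FE v u
    FE⊆G     : ∀ {u v} → FE u v → Adj G u v
    acyclic  : ∀ v vs → ¬ IsCycle FE v vs
    W        : Fin (N G) → Subset (N G)
    W⊆V      : ∀ {x} → x ∈ V G → W x ⊆ V G
    nonempty : ∀ {u} → u ∈ V G → ∃ λ x → x ∈ V G × u ∈ W x
    connected : ∀ {u} → u ∈ V G → InducedConnected FE (λ x → x ∈ V G × u ∈ W x)
    edges    : ∀ {u v} → Adj G u v → ∃ λ x → x ∈ V G × u ∈ W x × v ∈ W x
    own      : ∀ {u} → u ∈ V G → u ∈ W u
open SuitableFD public

width : {G : Graph} → SuitableFD G → ℕ
width {G} D = foldr _⊔_ 0
  (map (λ x → if lookup (V G) x then ∣ W D x ∣ ∸ 1 else 0) (allFin (N G)))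

IsCmp : Graph → ℕ → Set₁
IsCmp G c = (Σ (SuitableFD G) λ D → width D ≡ c) × (∀ (D : SuitableFD G) → c ≤ width D)

-- Put the vertices of X back one at a time.  To reinsert x into a suitable forest
-- decomposition of G − X, join x to one neighbour of x in every tree of the forest that
-- contains such a neighbour, give x the bag {x}, and add x to every bag of those trees.
-- Choosing the least-indexed neighbour per tree keeps the forest acyclic, the bags containing
-- x form a subtree around x, every edge at x lies in the bag of its other endpoint, and each
-- bag grows by at most one vertex.

module Submission where

open import Defs
open import Data.Nat using (ℕ; _+_; _≤_)
open import Data.Fin.Subset using (Subset; _⊆_; ∣_∣)

open import Level using (0ℓ)
open import Data.Bool using (true; false; if_then_else_)
open import Data.Fin using (Fin; zero; suc; toℕ; _≟_)
open import Data.Fin.Properties using (toℕ-injective; any?; sequence)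
open import Data.Fin.Subset using (_∈_; _∉_; _∪_; ∁; ⁅_⁆; _-_; Empty)
open import Data.Fin.Subset.Properties
  using (x∈⁅x⁆; x∈⁅y⁆⇒x≡y; x∈p∩q⁺; x∈p∩q⁻; x∈p∪q⁺; x∈p∪q⁻; x∈∁p⇒x∉p; x∉p⇒x∈∁p;
         p⊆q⇒∣p∣≤∣q∣; ∣⁅x⁆∣≡1; p─q⊆p; x∈p∧x≢y⇒x∈p-y; x∈p⇒∣p-x∣<∣p∣; nonempty?)
open import Data.List using ([]; _∷_; _++_; _∷ʳ_; foldr; map; allFin)
import Data.List.Properties as List
open import Data.List.Relation.Unary.All as All using (All; []; _∷_)
import Data.List.Relation.Unary.All.Properties as All
open import Data.List.Relation.Unary.Any as Any using (here; there)
open import Data.List.Relation.Unary.Linked using (Linked; []; [-]; _∷_)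
open import Data.List.Relation.Unary.Unique.Propositional using (Unique; []; _∷_)
open import Data.List.Membership.Propositional using () renaming (_∈_ to _∈ₗ_)
open import Data.List.Membership.Propositional.Properties using (∈-∃++)
open import Data.Nat using (zero; suc; _∸_; _⊔_; z≤n; s≤s; s≤s⁻¹; _≤?_)
open import Data.Nat.Properties
  using (≤-refl; ≤-trans; ≤-reflexive; ≤-antisym; <-≤-trans; n≮0; +-comm; +-suc; +-identityʳ; +-assoc;
         +-monoˡ-≤; +-monoʳ-≤; m≤n+m∸n; m+n∸n≡m; ∸-monoˡ-≤; n≤1+n; ⊔-lub; m≤m⊔n; m≤n⊔m; module ≤-Reasoning)
open import Data.Product using (Σ; ∃; _×_; _,_; proj₁; proj₂)
open import Data.Sum using (_⊎_; inj₁; inj₂)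
open import Data.Vec using (lookup; []; _∷_; there)
open import Data.Vec.Properties using ([]=⇒lookup; lookup⇒[]=)
open import Effect.Monad using (RawMonad)
open import Relation.Binary.Construct.Closure.ReflexiveTransitive as Star using (Star; ε; _◅_; _◅◅_)
open import Relation.Binary.PropositionalEquality using (_≡_; _≢_; refl; trans; cong; subst; ≢-sym)
  renaming (sym to ≡-sym)
open import Relation.Nullary using (¬_; Dec; yes; no; contradiction)
open import Relation.Nullary.Decidable using (¬¬-excluded-middle; decidable-stable; _×-dec_)
open import Relation.Nullary.Negation using (¬¬-Monad; ¬¬-map)
open import Relation.Unary using (Pred; Decidable)

∃⟶∃-smallest : ∀ {n} {P : Pred (Fin n) 0ℓ} → Decidable P → ∃ P →
               ∃ λ i → P i × (∀ j → P j → toℕ i ≤ toℕ j)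
∃⟶∃-smallest {zero} P? (() , _)
∃⟶∃-smallest {suc n} P? ∃P with P? zero
... | yes P0 = zero , P0 , λ _ _ → z≤n
... | no ¬P0 with ∃P
...   | zero , P0 = contradiction P0 ¬P0
...   | suc i , Pi with ∃⟶∃-smallest (λ j → P? (suc j)) (i , Pi)
...     | k , Pk , k-min =
  suc k , Pk , λ { zero P0 → contradiction P0 ¬P0 ; (suc j) Pj → s≤s (k-min j Pj) }

¬¬-decidable : ∀ {n} (P : Pred (Fin n) 0ℓ) → ¬ ¬ (∀ i → Dec (P i))
¬¬-decidable P = sequence (RawMonad.rawApplicative ¬¬-Monad) (λ _ → ¬¬-excluded-middle)

¬¬-decidable₂ : ∀ {n} (P : Fin n → Fin n → Set) → ¬ ¬ (∀ i j → Dec (P i j))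
¬¬-decidable₂ P = sequence (RawMonad.rawApplicative ¬¬-Monad) (λ i → ¬¬-decidable (P i))

max-map-≤ : ∀ {A : Set} (f g : A → ℕ) c xs → (∀ y → f y ≤ g y + c) →
  foldr _⊔_ 0 (map f xs) ≤ foldr _⊔_ 0 (map g xs) + c
max-map-≤ f g c [] f≤g = z≤n
max-map-≤ f g c (y ∷ ys) f≤g = ⊔-lub
  (≤-trans (f≤g y) (+-monoˡ-≤ c (m≤m⊔n (g y) _)))
  (≤-trans (max-map-≤ f g c ys f≤g) (+-monoˡ-≤ c (m≤n⊔m (g y) _)))

∣p∪q∣≤∣p∣+∣q∣ : ∀ {n} (p q : Subset n) → ∣ p ∪ q ∣ ≤ ∣ p ∣ + ∣ q ∣
∣p∪q∣≤∣p∣+∣q∣ [] [] = z≤n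
∣p∪q∣≤∣p∣+∣q∣ (true ∷ p) (true ∷ q) =
  s≤s (≤-trans (∣p∪q∣≤∣p∣+∣q∣ p q) (≤-trans (n≤1+n _) (≤-reflexive (≡-sym (+-suc ∣ p ∣ ∣ q ∣)))))
∣p∪q∣≤∣p∣+∣q∣ (true ∷ p) (false ∷ q) = s≤s (∣p∪q∣≤∣p∣+∣q∣ p q)
∣p∪q∣≤∣p∣+∣q∣ (false ∷ p) (true ∷ q) =
  ≤-trans (s≤s (∣p∪q∣≤∣p∣+∣q∣ p q)) (≤-reflexive (≡-sym (+-suc ∣ p ∣ ∣ q ∣)))
∣p∪q∣≤∣p∣+∣q∣ (false ∷ p) (false ∷ q) = ∣p∪q∣≤∣p∣+∣q∣ p q

x∉p-x : ∀ {n} (p : Subset n) x → x ∉ p - x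
x∉p-x (s ∷ p) zero ()
x∉p-x (s ∷ p) (suc x) (there x∈p-x) = x∉p-x p x x∈p-x

Star-restrict : ∀ {A : Set} {R : A → A → Set} {P : Pred A 0ℓ} {a b} →
  (∀ {z} → Star R a z → P z) → Star R a b → Star (λ u v → R u v × P u × P v) a b
Star-restrict P-reach ε = ε
Star-restrict P-reach (r ◅ rs) =
  (r , P-reach ε , P-reach (r ◅ ε)) ◅ Star-restrict (λ rs′ → P-reach (r ◅ rs′)) rs

module _ {n : ℕ} {R : Fin n → Fin n → Set} where

  Unique-∷⇒Unique-∷ʳ : ∀ {a : Fin n} xs → Unique (a ∷ xs) → Unique (xs ∷ʳ a)
  Unique-∷⇒Unique-∷ʳ [] _ = [] ∷ []
  Unique-∷⇒Unique-∷ʳ (b ∷ ys) ((a≢b ∷ a∉ys) ∷ (b∉ys ∷ ys-unique)) =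
    All.∷ʳ⁺ b∉ys (≢-sym a≢b) ∷ Unique-∷⇒Unique-∷ʳ ys (a∉ys ∷ ys-unique)

  Linked-∷ʳ⁺ : ∀ xs {a b : Fin n} → Linked R (xs ∷ʳ a) → R a b → Linked R (xs ∷ʳ a ∷ʳ b)
  Linked-∷ʳ⁺ [] [-] r = r ∷ [-]
  Linked-∷ʳ⁺ (y ∷ []) (r₁ ∷ [-]) r = r₁ ∷ r ∷ [-]
  Linked-∷ʳ⁺ (y ∷ z ∷ zs) (r₁ ∷ rs) r = r₁ ∷ Linked-∷ʳ⁺ (z ∷ zs) rs r

  IsCycle-rotate : ∀ {v w : Fin n} ws → IsCycle R v (w ∷ ws) → IsCycle R w (ws ∷ʳ v)
  IsCycle-rotate {v} {w} ws (((v≢w ∷ v∉ws) ∷ (w∉ws ∷ ws-unique)) , s≤s 1≤∣ws∣ , (r ∷ rs)) =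
    (All.∷ʳ⁺ w∉ws (≢-sym v≢w) ∷ Unique-∷⇒Unique-∷ʳ ws (v∉ws ∷ ws-unique)) ,
    subst (2 ≤_) (≡-sym (List.length-++ ws)) (+-monoˡ-≤ 1 1≤∣ws∣) ,
    Linked-∷ʳ⁺ (w ∷ ws) rs r

  IsCycle-rotate-to : ∀ {v x : Fin n} {vs} → x ∈ₗ (v ∷ vs) → IsCycle R v vs → ∃ λ ws → IsCycle R x ws
  IsCycle-rotate-to x∈ cycle with ∈-∃++ x∈
  ... | [] , _ , refl = _ , cycle
  ... | (a ∷ as) , bs , refl = rotate-past as cycle
    where
    rotate-past : ∀ as {v x : Fin n} {bs} → IsCycle R v (as ++ x ∷ bs) → ∃ λ ws → IsCycle R x ws
    rotate-past [] {bs = bs} cycle = _ , IsCycle-rotate bs cycle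
    rotate-past (a ∷ as) {v} {x} {bs} cycle =
      rotate-past as (subst (IsCycle R a) (List.++-assoc as (x ∷ bs) (v ∷ []))
                        (IsCycle-rotate (as ++ x ∷ bs) cycle))

  Linked-map-All : ∀ {S : Fin n → Fin n → Set} {P : Pred (Fin n) 0ℓ} →
    (∀ {a b} → P a → P b → R a b → S a b) → ∀ {xs} → All P xs → Linked R xs → Linked S xs
  Linked-map-All f _ [] = []
  Linked-map-All f _ [-] = [-]
  Linked-map-All f (Pa ∷ Pb ∷ Ps) (r ∷ rs) = f Pa Pb r ∷ Linked-map-All f (Pb ∷ Ps) rs

module _ (G : Graph) {Y : Subset (N G)} where

  ∈-─⁺ : ∀ {y} → y ∈ V G → y ∉ Y → y ∈ V (G ─ Y)
  ∈-─⁺ y∈V y∉Y = x∈p∩q⁺ (y∈V , x∉p⇒x∈∁p y∉Y)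

  ∈-─⁻ : ∀ {y} → y ∈ V (G ─ Y) → y ∈ V G × y ∉ Y
  ∈-─⁻ y∈V-Y with x∈p∩q⁻ (V G) (∁ Y) y∈V-Y
  ... | y∈V , y∈∁Y = y∈V , x∈∁p⇒x∉p y∈∁Y

bagWidth : {G : Graph} → SuitableFD G → Fin (N G) → ℕ
bagWidth {G} D y = if lookup (V G) y then ∣ W D y ∣ ∸ 1 else 0

bagWidth-≤ : {G : Graph} (D : SuitableFD G) {y : Fin (N G)} {m : ℕ} →
  (y ∈ V G → ∣ W D y ∣ ∸ 1 ≤ m) → bagWidth D y ≤ m
bagWidth-≤ {G} D {y} bound with lookup (V G) y in eq
... | true = bound (lookup⇒[]= y (V G) eq)
... | false = z≤n

bagWidth-∈ : {G : Graph} (D : SuitableFD G) {y : Fin (N G)} → y ∈ V G → bagWidth D y ≡ ∣ W D y ∣ ∸ 1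
bagWidth-∈ {G} D {y} y∈V rewrite []=⇒lookup y∈V = refl

undelete-∅ : (G : Graph) {X : Subset (N G)} → Empty X → (D : SuitableFD (G ─ X)) →
  Σ (SuitableFD G) λ E → width E ≤ width D + 0
undelete-∅ G {X} X-empty D = E , max-map-≤ (bagWidth E) (bagWidth D) 0 (allFin (N G)) bagWidth-E
  where
  ∉X : ∀ y → y ∉ X
  ∉X y y∈X = X-empty (y , y∈X)
  to : ∀ {y} → y ∈ V G → y ∈ V (G ─ X)
  to y∈V = ∈-─⁺ G y∈V (∉X _)
  from : ∀ {y} → y ∈ V (G ─ X) → y ∈ V G
  from y∈V = proj₁ (∈-─⁻ G y∈V)
  E : SuitableFD G
  E = record
    { FE = FE D ; FE-sym = FE-sym D ; FE⊆G = λ f → proj₁ (FE⊆G D f) ; acyclic = acyclic D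
    ; W = W D ; W⊆V = λ y∈V u∈W → from (W⊆V D (to y∈V) u∈W)
    ; nonempty = λ u∈V → let (y , y∈V , u∈W) = nonempty D (to u∈V) in y , from y∈V , u∈W
    ; connected = λ u∈V (a∈V , u∈Wa) (b∈V , u∈Wb) →
        Star.map (λ (f , (c∈V , u∈Wc) , (d∈V , u∈Wd)) → f , (from c∈V , u∈Wc) , (from d∈V , u∈Wd))
          (connected D (to u∈V) (to a∈V , u∈Wa) (to b∈V , u∈Wb))
    ; edges = λ {u} {v} uv →
        let (y , y∈V , u∈W , v∈W) = edges D (uv , ∉X u , ∉X v) in y , from y∈V , u∈W , v∈W
    ; own = λ u∈V → own D (to u∈V) }
  bagWidth-E : ∀ y → bagWidth E y ≤ bagWidth D y + 0
  bagWidth-E y = bagWidth-≤ E λ y∈V →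
    ≤-reflexive (trans (≡-sym (bagWidth-∈ D (to y∈V))) (≡-sym (+-identityʳ _)))

module Reinsertion (G : Graph) {X : Subset (N G)} {x : Fin (N G)} (x∈X : x ∈ X) (x∈V : x ∈ V G)
  (D : SuitableFD (G ─ X))
  (adj? : ∀ w → Dec (Adj (G ─ (X - x)) x w))
  (reach? : ∀ w y → Dec (Star (FE D) w y)) where

  H : Graph
  H = G ─ (X - x)

  F : Fin (N G) → Fin (N G) → Set
  F = FE D

  ∉X⇒≢x : ∀ {y} → y ∉ X → y ≢ x
  ∉X⇒≢x y∉X refl = y∉X x∈X

  ∉X⇒∉X-x : ∀ {y} → y ∉ X → y ∉ X - x
  ∉X⇒∉X-x y∉X y∈X-x = y∉X (p─q⊆p X ⁅ x ⁆ y∈X-x)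

  ∉X-x⇒∉X : ∀ {y} → y ∉ X - x → y ≢ x → y ∉ X
  ∉X-x⇒∉X y∉X-x y≢x y∈X = y∉X-x (x∈p∧x≢y⇒x∈p-y y∈X y≢x)

  x∈V-H : x ∈ V H
  x∈V-H = ∈-─⁺ G x∈V (x∉p-x X x)

  ∈V-H⇒∈V-D : ∀ {y} → y ∈ V H → y ≢ x → y ∈ V (G ─ X)
  ∈V-H⇒∈V-D y∈V-H y≢x with ∈-─⁻ G y∈V-H
  ... | y∈V , y∉X-x = ∈-─⁺ G y∈V (∉X-x⇒∉X y∉X-x y≢x)

  ∈V-D⇒∈V-H : ∀ {y} → y ∈ V (G ─ X) → y ∈ V H × y ≢ x
  ∈V-D⇒∈V-H y∈V-D with ∈-─⁻ G y∈V-D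
  ... | y∈V , y∉X = ∈-─⁺ G y∈V (∉X⇒∉X-x y∉X) , ∉X⇒≢x y∉X

  F⇒Adj-H : ∀ {u v} → F u v → Adj H u v × u ≢ x × v ≢ x
  F⇒Adj-H f with FE⊆G D f
  ... | uv , u∉X , v∉X = (uv , ∉X⇒∉X-x u∉X , ∉X⇒∉X-x v∉X) , ∉X⇒≢x u∉X , ∉X⇒≢x v∉X

  Adj-H⇒Adj-D : ∀ {u v} → Adj H u v → u ≢ x → v ≢ x → Adj (G ─ X) u v
  Adj-H⇒Adj-D (uv , u∉X-x , v∉X-x) u≢x v≢x = uv , ∉X-x⇒∉X u∉X-x u≢x , ∉X-x⇒∉X v∉X-x v≢x

  Star-F-preserves-V : ∀ {a z} → Star F a z → a ∈ V (G ─ X) → z ∈ V (G ─ X)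
  Star-F-preserves-V ε a∈V = a∈V
  Star-F-preserves-V (f ◅ fs) _ = Star-F-preserves-V fs (proj₂ (adjV (G ─ X) (FE⊆G D f)))

  Attached : Pred (Fin (N G)) 0ℓ
  Attached y = ∃ λ w → Adj H x w × Star F w y

  attached? : Decidable Attached
  attached? y = any? (λ w → adj? w ×-dec reach? w y)

  -- x is joined to the least-indexed of its neighbours in each tree of F, so that no cycle appears.
  Anchor : Pred (Fin (N G)) 0ℓ
  Anchor c = Adj H x c × (∀ w → Adj H x w → Star F w c → toℕ c ≤ toℕ w)

  anchor-unique : ∀ {c d} → Anchor c → Anchor d → Star F c d → c ≡ d
  anchor-unique (xc , c-min) (xd , d-min) c⇝d = toℕ-injective
    (≤-antisym (c-min _ xd (Star.reverse (FE-sym D) c⇝d)) (d-min _ xc c⇝d))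

  anchor-of : ∀ {y} → Attached y → ∃ λ c → Anchor c × Star F c y
  anchor-of {y} attached with ∃⟶∃-smallest (λ w → adj? w ×-dec reach? w y) attached
  ... | c , (xc , c⇝y) , c-min = c , (xc , λ w xw w⇝c → c-min w (xw , w⇝c ◅◅ c⇝y)) , c⇝y

  anchor≢x : ∀ {c} → Anchor c → c ≢ x
  anchor≢x (xc , _) refl = irr H xc

  FE⁺ : Fin (N G) → Fin (N G) → Set
  FE⁺ u v = F u v ⊎ (u ≡ x × Anchor v) ⊎ (v ≡ x × Anchor u)

  FE⁺-sym : ∀ {u v} → FE⁺ u v → FE⁺ v u
  FE⁺-sym (inj₁ f) = inj₁ (FE-sym D f)
  FE⁺-sym (inj₂ (inj₁ xv)) = inj₂ (inj₂ xv)
  FE⁺-sym (inj₂ (inj₂ ux)) = inj₂ (inj₁ ux)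

  FE⁺⊆H : ∀ {u v} → FE⁺ u v → Adj H u v
  FE⁺⊆H (inj₁ f) = proj₁ (F⇒Adj-H f)
  FE⁺⊆H (inj₂ (inj₁ (refl , xv , _))) = xv
  FE⁺⊆H (inj₂ (inj₂ (refl , xu , _))) = sym H xu

  FE⁺⇒F : ∀ {a b} → x ≢ a → x ≢ b → FE⁺ a b → F a b
  FE⁺⇒F _ _ (inj₁ f) = f
  FE⁺⇒F x≢a _ (inj₂ (inj₁ (a≡x , _))) = contradiction (≡-sym a≡x) x≢a
  FE⁺⇒F _ x≢b (inj₂ (inj₂ (b≡x , _))) = contradiction (≡-sym b≡x) x≢b

  FE⁺-from-x⇒Anchor : ∀ {c} → FE⁺ x c → Anchor c
  FE⁺-from-x⇒Anchor (inj₁ f) = contradiction refl (proj₁ (proj₂ (F⇒Adj-H f)))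
  FE⁺-from-x⇒Anchor (inj₂ (inj₁ (_ , anchor))) = anchor
  FE⁺-from-x⇒Anchor (inj₂ (inj₂ (refl , anchor))) = anchor

  path-to-x : ∀ a ys → All (x ≢_) (a ∷ ys) → Linked FE⁺ (a ∷ ys ∷ʳ x) →
    ∃ λ b → b ∈ₗ (a ∷ ys) × Star F a b × FE⁺ b x
  path-to-x a [] _ (e ∷ [-]) = a , here refl , ε , e
  path-to-x a (y ∷ ys) (x≢a ∷ x≢ys) (e ∷ es) with path-to-x y ys x≢ys es
  ... | b , b∈ys , y⇝b , bx = b , there b∈ys , FE⁺⇒F x≢a (All.head x≢ys) e ◅ y⇝b , bx

  -- Walking round the cycle from x, its first and last vertices are anchors joined by a path of F.
  no-cycle-through-x : ∀ ws → ¬ IsCycle FE⁺ x ws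
  no-cycle-through-x [] (_ , () , _)
  no-cycle-through-x (_ ∷ []) (_ , s≤s () , _)
  no-cycle-through-x (c ∷ d ∷ ws) (((x≢c ∷ x≢dws) ∷ (c∉dws ∷ _)) , _ , (xc ∷ cd ∷ dws))
    with path-to-x d ws x≢dws dws
  ... | b , b∈dws , d⇝b , bx = All.lookup c∉dws b∈dws
    (anchor-unique (FE⁺-from-x⇒Anchor xc) (FE⁺-from-x⇒Anchor (FE⁺-sym bx))
      (FE⁺⇒F x≢c (All.head x≢dws) cd ◅ d⇝b))

  acyclic⁺ : ∀ v vs → ¬ IsCycle FE⁺ v vs
  acyclic⁺ v vs cycle@(unique , long , linked) with Any.any? (x ≟_) (v ∷ vs)
  ... | yes x∈cycle = let (ws , cycle′) = IsCycle-rotate-to x∈cycle cycle in no-cycle-through-x ws cycle′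
  ... | no x∉cycle =
    acyclic D v vs (unique , long , Linked-map-All FE⁺⇒F (All.∷ʳ⁺ x≢vs (All.head x≢vs)) linked)
    where
    x≢vs : All (x ≢_) (v ∷ vs)
    x≢vs = All.¬Any⇒All¬ (v ∷ vs) x∉cycle

  -- W D x is junk (x is not a vertex of G ─ X), hence the separate bag for x.
  W⁺ : Fin (N G) → Subset (N G)
  W⁺ y with y ≟ x
  ... | yes _ = ⁅ x ⁆
  ... | no _ with attached? y
  ...   | yes _ = W D y ∪ ⁅ x ⁆
  ...   | no _ = W D y

  x∈W⁺x : x ∈ W⁺ x
  x∈W⁺x with x ≟ x
  ... | yes _ = x∈⁅x⁆ x
  ... | no x≢x = contradiction refl x≢x

  W⊆W⁺ : ∀ {y} → y ≢ x → W D y ⊆ W⁺ y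
  W⊆W⁺ {y} y≢x u∈W with y ≟ x
  ... | yes y≡x = contradiction y≡x y≢x
  ... | no _ with attached? y
  ...   | yes _ = x∈p∪q⁺ (inj₁ u∈W)
  ...   | no _ = u∈W

  x∈W⁺ : ∀ {y} → y ≢ x → Attached y → x ∈ W⁺ y
  x∈W⁺ {y} y≢x attached with y ≟ x
  ... | yes y≡x = contradiction y≡x y≢x
  ... | no _ with attached? y
  ...   | yes _ = x∈p∪q⁺ (inj₂ (x∈⁅x⁆ x))
  ...   | no ¬attached = contradiction attached ¬attached

  ∈W⁺⁻ : ∀ {y u} → u ∈ W⁺ y → (y ≡ x × u ≡ x) ⊎ (y ≢ x × (u ∈ W D y ⊎ (u ≡ x × Attached y)))
  ∈W⁺⁻ {y} u∈W⁺ with y ≟ x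
  ... | yes y≡x = inj₁ (y≡x , x∈⁅y⁆⇒x≡y x u∈W⁺)
  ... | no y≢x with attached? y
  ...   | no _ = inj₂ (y≢x , inj₁ u∈W⁺)
  ...   | yes attached with x∈p∪q⁻ (W D y) ⁅ x ⁆ u∈W⁺
  ...     | inj₁ u∈W = inj₂ (y≢x , inj₁ u∈W)
  ...     | inj₂ u∈⁅x⁆ = inj₂ (y≢x , inj₂ (x∈⁅y⁆⇒x≡y x u∈⁅x⁆ , attached))

  W⁺x⊆⁅x⁆ : W⁺ x ⊆ ⁅ x ⁆
  W⁺x⊆⁅x⁆ u∈W⁺x with ∈W⁺⁻ u∈W⁺x
  ... | inj₁ (_ , refl) = x∈⁅x⁆ x
  ... | inj₂ (x≢x , _) = contradiction refl x≢x

  own⁺ : ∀ {u} → u ∈ V H → u ∈ W⁺ u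
  own⁺ {u} u∈V = by-cases (u ≟ x)
    where
    by-cases : Dec (u ≡ x) → u ∈ W⁺ u
    by-cases (yes refl) = x∈W⁺x
    by-cases (no u≢x) = W⊆W⁺ u≢x (own D (∈V-H⇒∈V-D u∈V u≢x))

  W⁺⊆V : ∀ {y} → y ∈ V H → W⁺ y ⊆ V H
  W⁺⊆V y∈V u∈W⁺ with ∈W⁺⁻ u∈W⁺
  ... | inj₁ (_ , refl) = x∈V-H
  ... | inj₂ (_ , inj₂ (refl , _)) = x∈V-H
  ... | inj₂ (y≢x , inj₁ u∈W) = proj₁ (∈V-D⇒∈V-H (W⊆V D (∈V-H⇒∈V-D y∈V y≢x) u∈W))

  edges⁺ : ∀ {u v} → Adj H u v → ∃ λ y → y ∈ V H × u ∈ W⁺ y × v ∈ W⁺ y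
  edges⁺ {u} {v} uv with u ≟ x | v ≟ x | adjV H uv
  ... | yes refl | yes refl | _ = contradiction uv (irr H)
  ... | yes refl | no v≢x | _ , v∈V = v , v∈V , x∈W⁺ v≢x (v , uv , ε) , own⁺ v∈V
  ... | no u≢x | yes refl | u∈V , _ = u , u∈V , own⁺ u∈V , x∈W⁺ u≢x (u , sym H uv , ε)
  ... | no u≢x | no v≢x | _ with edges D (Adj-H⇒Adj-D uv u≢x v≢x)
  ...   | y , y∈V , u∈W , v∈W with ∈V-D⇒∈V-H y∈V
  ...     | y∈V-H , y≢x = y , y∈V-H , W⊆W⁺ y≢x u∈W , W⊆W⁺ y≢x v∈W

  Holds : Fin (N G) → Pred (Fin (N G)) 0ℓ
  Holds u y = y ∈ V H × u ∈ W⁺ y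

  x-reaches-its-bags : ∀ {y} → Holds x y → Star (λ a b → FE⁺ a b × Holds x a × Holds x b) x y
  x-reaches-its-bags {y} (y∈V , x∈W⁺y) with ∈W⁺⁻ {y} x∈W⁺y
  ... | inj₁ (refl , _) = ε
  ... | inj₂ (y≢x , inj₁ x∈W) = contradiction refl (proj₂ (∈V-D⇒∈V-H (W⊆V D (∈V-H⇒∈V-D y∈V y≢x) x∈W)))
  ... | inj₂ (_ , inj₂ (_ , attached)) with anchor-of attached
  ...   | c , anchor , c⇝y =
    (inj₂ (inj₁ (refl , anchor)) , (x∈V-H , x∈W⁺x) , holds-x ε) ◅
    Star.map (λ (f , ha , hb) → inj₁ f , ha , hb) (Star-restrict holds-x c⇝y)
    where
    c∈V-D : c ∈ V (G ─ X)
    c∈V-D = ∈V-H⇒∈V-D (proj₂ (adjV H (proj₁ anchor))) (anchor≢x anchor)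
    holds-x : ∀ {z} → Star F c z → Holds x z
    holds-x c⇝z with ∈V-D⇒∈V-H (Star-F-preserves-V c⇝z c∈V-D)
    ... | z∈V , z≢x = z∈V , x∈W⁺ z≢x (c , proj₁ anchor , c⇝z)

  connected⁺ : ∀ {u} → u ∈ V H → InducedConnected FE⁺ (Holds u)
  connected⁺ {u} u∈V with u ≟ x
  ... | yes refl = λ ha hb →
    Star.reverse (λ (f , ha , hb) → FE⁺-sym f , hb , ha) (x-reaches-its-bags ha) ◅◅ x-reaches-its-bags hb
  ... | no u≢x = λ ha hb →
    Star.map (λ (f , ha , hb) → inj₁ f , extend ha , extend hb)
      (connected D (∈V-H⇒∈V-D u∈V u≢x) (restrict ha) (restrict hb))
    where
    restrict : ∀ {y} → Holds u y → y ∈ V (G ─ X) × u ∈ W D y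
    restrict (y∈V , u∈W⁺) with ∈W⁺⁻ u∈W⁺
    ... | inj₁ (_ , u≡x) = contradiction u≡x u≢x
    ... | inj₂ (_ , inj₂ (u≡x , _)) = contradiction u≡x u≢x
    ... | inj₂ (y≢x , inj₁ u∈W) = ∈V-H⇒∈V-D y∈V y≢x , u∈W
    extend : ∀ {y} → y ∈ V (G ─ X) × u ∈ W D y → Holds u y
    extend (y∈V , u∈W) with ∈V-D⇒∈V-H y∈V
    ... | y∈V-H , y≢x = y∈V-H , W⊆W⁺ y≢x u∈W

  D⁺ : SuitableFD H
  D⁺ = record
    { FE = FE⁺ ; FE-sym = FE⁺-sym ; FE⊆G = FE⁺⊆H ; acyclic = acyclic⁺
    ; W = W⁺ ; W⊆V = W⁺⊆V
    ; nonempty = λ {u} u∈V → u , u∈V , own⁺ u∈V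
    ; connected = connected⁺ ; edges = edges⁺ ; own = own⁺ }

  ∣W⁺∣≤∣W∣+1 : ∀ {y} → y ≢ x → ∣ W⁺ y ∣ ≤ ∣ W D y ∣ + 1
  ∣W⁺∣≤∣W∣+1 {y} y≢x = begin
    ∣ W⁺ y ∣              ≤⟨ p⊆q⇒∣p∣≤∣q∣ W⁺⊆W∪⁅x⁆ ⟩
    ∣ W D y ∪ ⁅ x ⁆ ∣     ≤⟨ ∣p∪q∣≤∣p∣+∣q∣ (W D y) ⁅ x ⁆ ⟩
    ∣ W D y ∣ + ∣ ⁅ x ⁆ ∣ ≡⟨ cong (∣ W D y ∣ +_) (∣⁅x⁆∣≡1 x) ⟩
    ∣ W D y ∣ + 1         ∎
    where
    open ≤-Reasoning
    W⁺⊆W∪⁅x⁆ : W⁺ y ⊆ W D y ∪ ⁅ x ⁆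
    W⁺⊆W∪⁅x⁆ u∈W⁺ with ∈W⁺⁻ u∈W⁺
    ... | inj₁ (y≡x , _) = contradiction y≡x y≢x
    ... | inj₂ (_ , inj₁ u∈W) = x∈p∪q⁺ (inj₁ u∈W)
    ... | inj₂ (_ , inj₂ (refl , _)) = x∈p∪q⁺ (inj₂ (x∈⁅x⁆ x))

  bagWidth⁺ : ∀ y → bagWidth D⁺ y ≤ bagWidth D y + 1
  bagWidth⁺ y = bagWidth-≤ D⁺ λ y∈V → by-cases y∈V (y ≟ x)
    where
    open ≤-Reasoning
    by-cases : y ∈ V H → Dec (y ≡ x) → ∣ W⁺ y ∣ ∸ 1 ≤ bagWidth D y + 1
    by-cases _ (yes refl) =
      ≤-trans (∸-monoˡ-≤ 1 (≤-trans (p⊆q⇒∣p∣≤∣q∣ W⁺x⊆⁅x⁆) (≤-reflexive (∣⁅x⁆∣≡1 x)))) z≤n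
    by-cases y∈V (no y≢x) = begin
      ∣ W⁺ y ∣ ∸ 1           ≤⟨ ∸-monoˡ-≤ 1 (∣W⁺∣≤∣W∣+1 y≢x) ⟩
      ∣ W D y ∣ + 1 ∸ 1      ≡⟨ m+n∸n≡m _ 1 ⟩
      ∣ W D y ∣              ≤⟨ m≤n+m∸n _ 1 ⟩
      1 + (∣ W D y ∣ ∸ 1)    ≡⟨ +-comm 1 _ ⟩
      (∣ W D y ∣ ∸ 1) + 1    ≡⟨ cong (_+ 1) (bagWidth-∈ D (∈V-H⇒∈V-D y∈V y≢x)) ⟨
      bagWidth D y + 1       ∎

  reinsert : Σ (SuitableFD H) λ E → width E ≤ width D + 1
  reinsert = D⁺ , max-map-≤ (bagWidth D⁺) (bagWidth D) 1 (allFin (N G)) bagWidth⁺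

-- Adjacency and reachability need not be decidable; the oracles are classical, so the
-- induction lives in ¬¬ and lemma3p3 escapes because its conclusion is decidable.
reinsert-all : (G : Graph) (k : ℕ) (X : Subset (N G)) → ∣ X ∣ ≤ k → X ⊆ V G →
  (D : SuitableFD (G ─ X)) →
  ¬ ¬ (Σ (SuitableFD G) λ E → width E ≤ width D + ∣ X ∣)
reinsert-all G k X _ _ D with nonempty? X
... | no X-empty = λ ¬goal →
  let (E , E≤D) = undelete-∅ G X-empty D in ¬goal (E , ≤-trans E≤D (+-monoʳ-≤ (width D) z≤n))
reinsert-all G zero X ∣X∣≤0 _ D | yes (x , x∈X) = contradiction (<-≤-trans (x∈p⇒∣p-x∣<∣p∣ x∈X) ∣X∣≤0) n≮0
reinsert-all G (suc k) X ∣X∣≤1+k X⊆V D | yes (x , x∈X) = λ ¬goal →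
  ¬¬-decidable (Adj (G ─ (X - x)) x) λ adj? →
  ¬¬-decidable₂ (Star (FE D)) λ reach? →
  let (E , E≤D+1) = Reinsertion.reinsert G x∈X (X⊆V x∈X) D adj? reach? in
  reinsert-all G k (X - x) (s≤s⁻¹ (<-≤-trans (x∈p⇒∣p-x∣<∣p∣ x∈X) ∣X∣≤1+k))
    (λ u∈X-x → X⊆V (p─q⊆p X ⁅ x ⁆ u∈X-x)) E
    λ (E′ , E′≤E) → ¬goal (E′ , (begin
      width E′                    ≤⟨ E′≤E ⟩
      width E + ∣ X - x ∣         ≤⟨ +-monoˡ-≤ ∣ X - x ∣ E≤D+1 ⟩
      width D + 1 + ∣ X - x ∣     ≡⟨ +-assoc (width D) 1 ∣ X - x ∣ ⟩
      width D + suc ∣ X - x ∣     ≤⟨ +-monoʳ-≤ (width D) (x∈p⇒∣p-x∣<∣p∣ x∈X) ⟩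
      width D + ∣ X ∣             ∎))
  where open ≤-Reasoning

lemma3p3 : (G : Graph) (X : Subset (N G)) → X ⊆ V G →
    (a b : ℕ) → IsCmp G a → IsCmp (G ─ X) b → a ≤ b + ∣ X ∣
lemma3p3 G X X⊆V a b (_ , a-minimal) ((D , refl) , _) =
  decidable-stable (a ≤? width D + ∣ X ∣)
    (¬¬-map (λ (E , E≤D+∣X∣) → ≤-trans (a-minimal E) E≤D+∣X∣) (reinsert-all G ∣ X ∣ X ≤-refl X⊆V D))
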